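{- Let $h\in\mathbb{Z}$ and $n\ge0$ be integers. The number of partitions $\lambda=(\lambda_1,\dots,\lambda_t)\vdash n$ having an $h$-fixed hook arising from a part of size $1$ (i.e. there is $s$ with $1\le s\le t$, $h_{s,1}(\lambda)=s+h$ and $\lambda_s=1$) equals the number of partitions of $n-h$ which have at least $1-h$ parts and in which the part $1$ appears exactly once.
   Context: A partition $\lambda=(\lambda_1,\dots,\lambda_t)$ of $n$ is a nonincreasing sequence of positive integers with sum $n$; $t$ is its number of parts (length). First-column hook lengths: $h_{s,1}(\lambda)=\lambda_s+t-s$ for $1\le s\le t$. An $h$-fixed hook is an index $s$ with $h_{s,1}(\lambda)=s+h$. There are no partitions of a negative integer. -}

module Defs where

open import Data.Nat as ℕ using (ℕ; zero; suc; _≥_; _<_)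
open import Data.Integer as ℤ using (ℤ; +_; 1ℤ)
open import Data.List using (List; []; _∷_; length; lookup)
open import Data.Nat.ListAction using (sum)
open import Data.List.Relation.Unary.All using (All)
open import Data.List.Relation.Unary.Linked using (Linked)
open import Data.Fin using (Fin; toℕ)
open import Data.Product using (Σ; _×_)
open import Relation.Binary.PropositionalEquality using (_≡_)

IsPartition : ℕ → List ℕ → Set
IsPartition n λs = Linked _≥_ λs × All (0 <_) λs × sum λs ≡ n

-- A partition of an integer m (there are none when m is negative).
IsPartitionℤ : ℤ → List ℕ → Set
IsPartitionℤ m λs = Σ ℕ (λ k → (m ≡ + k) × IsPartition k λs)

-- First-column hook length h_{s,1} = λ_s + t - s, with s = toℕ i + 1 (1-based).
firstColHook : (λs : List ℕ) → Fin (length λs) → ℤ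
firstColHook λs i = (+ lookup λs i ℤ.+ + length λs) ℤ.- + suc (toℕ i)

HasFixedHookFromOne : ℤ → List ℕ → Set
HasFixedHookFromOne h λs =
  Σ (Fin (length λs)) (λ i →
    (lookup λs i ≡ 1) × (firstColHook λs i ≡ + suc (toℕ i) ℤ.+ h))

countOnes : List ℕ → ℕ
countOnes [] = 0
countOnes (suc zero ∷ xs) = suc (countOnes xs)
countOnes (_ ∷ xs) = countOnes xs

{-# OPTIONS --safe #-}
module Submission where

open import Defs
open import Data.Nat using (ℕ)
open import Data.Integer using (ℤ; +_; 1ℤ; _-_; _≤_)
open import Data.List using (List; length)
open import Data.Product using (Σ; _×_)
open import Function.Bundles using (_↔_)
open import Relation.Binary.PropositionalEquality using (_≡_)

open import Data.Nat using (zero; suc; _+_; _∸_; _<_; _≥_; s≤s; s≤s⁻¹; z≤n)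
import Data.Nat.Properties as ℕₚ
import Data.Nat.Tactic.RingSolver as ℕ-Solver
open import Data.Integer as ℤ using (0ℤ; ∣_∣; +≤+)
import Data.Integer.Properties as ℤₚ
open import Data.Integer.Tactic.RingSolver using (solve-∀)
open import Algebra.Properties.AbelianGroup ℤₚ.+-0-abelianGroup using (∙-cancelˡ; ∙-cancelʳ)
open import Data.List using ([]; _∷_; _++_; map; take; replicate; lookup)
open import Data.List.Properties using (length-take; length-replicate; map-injective; ++-cancelʳ)
open import Data.Nat.ListAction using (sum)
open import Data.Nat.ListAction.Properties using (sum-++)
open import Data.List.Relation.Unary.All as All using (All; []; _∷_)
open import Data.List.Relation.Unary.All.Properties using (++⁺; replicate⁺; take⁺)
open import Data.List.Relation.Unary.Linked as Linked using (Linked; []; [-]; _∷_)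
open import Data.List.Relation.Unary.Linked.Properties using (map⁻)
open import Data.Fin as Fin using (Fin; toℕ)
open import Data.Fin.Properties using (toℕ<n; toℕ-injective)
open import Data.Product using (_,_; proj₁; proj₂)
open import Function.Bundles using (_⇔_; mk⇔; mk↔ₛ′; Equivalence)
open import Relation.Binary.Definitions using (Reflexive)
open import Relation.Nullary.Irrelevant using (Irrelevant)
import Relation.Unary as U
open import Relation.Binary.PropositionalEquality
  using (refl; sym; trans; cong; cong₂; subst; module ≡-Reasoning)
open import Axiom.UniquenessOfIdentityProofs using (module Decidable⇒UIP)

-- If λ_s = 1 then every later part is 1 as well, so λ = (ν, 1^(e+1)) with
-- ν = (λ_1, …, λ_{s-1}), and h_{s,1} = e + 1.  The condition h_{s,1} = s + h thus
-- says e = (s - 1) + h, which determines s.  Adding a first column of height s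
-- to ν gives μ = (ν_1 + 1, …, ν_{s-1} + 1, 1): a partition of
-- |ν| + s = n - (e + 1) + s = n - h with s ≥ 1 - h parts and exactly one part 1.
-- Conversely such a μ determines ν, and then λ = (ν, 1^(s+h)).

Σ-≡-irrelevant : ∀ {A : Set} {P : A → Set} → U.Irrelevant P →
                 {x y : Σ A P} → proj₁ x ≡ proj₁ y → x ≡ y
Σ-≡-irrelevant P-irr {a , p} {.a , q} refl = cong (a ,_) (P-irr p q)

mk↔-irrelevant : ∀ {A B : Set} {P : A → Set} {Q : B → Set} →
                 U.Irrelevant P → U.Irrelevant Q →
                 (to : Σ A P → Σ B Q) (from : Σ B Q → Σ A P) →
                 (∀ y → proj₁ (to (from y)) ≡ proj₁ y) →
                 (∀ x → proj₁ (from (to x)) ≡ proj₁ x) →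
                 Σ A P ↔ Σ B Q
mk↔-irrelevant P-irr Q-irr to from to∘from from∘to =
  mk↔ₛ′ to from (λ y → Σ-≡-irrelevant Q-irr (to∘from y))
                (λ x → Σ-≡-irrelevant P-irr (from∘to x))

ℤ-≡-irrelevant : ∀ {a b : ℤ} → Irrelevant (a ≡ b)
ℤ-≡-irrelevant = Decidable⇒UIP.≡-irrelevant ℤ._≟_

Linked-++⁻ˡ : ∀ {A : Set} {R : A → A → Set} xs {ys} → Linked R (xs ++ ys) → Linked R xs
Linked-++⁻ˡ []           _        = []
Linked-++⁻ˡ (x ∷ [])     _        = [-]
Linked-++⁻ˡ (x ∷ y ∷ xs) (r ∷ rs) = r ∷ Linked-++⁻ˡ (y ∷ xs) rs

Linked-++-∷⁺ : ∀ {A : Set} {R : A → A → Set} {xs y ys} →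
               Linked R xs → All (λ x → R x y) xs → Linked R (y ∷ ys) →
               Linked R (xs ++ y ∷ ys)
Linked-++-∷⁺ []       []       l = l
Linked-++-∷⁺ [-]      (r ∷ []) l = r ∷ l
Linked-++-∷⁺ (r ∷ rs) (_ ∷ as) l = r ∷ Linked-++-∷⁺ rs as l

Linked-replicate : ∀ {A : Set} {R : A → A → Set} → Reflexive R →
                   ∀ n {x} → Linked R (replicate n x)
Linked-replicate R-refl zero          = []
Linked-replicate R-refl (suc zero)    = [-]
Linked-replicate R-refl (suc (suc n)) = R-refl ∷ Linked-replicate R-refl (suc n)

take-length-++ : ∀ {A : Set} (xs : List A) {ys} → take (length xs) (xs ++ ys) ≡ xs
take-length-++ []       = refl
take-length-++ (x ∷ xs) = cong (x ∷_) (take-length-++ xs)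

position : ∀ {A : Set} (xs : List A) {y ys} → Fin (length (xs ++ y ∷ ys))
position []       = Fin.zero
position (_ ∷ xs) = Fin.suc (position xs)

toℕ-position : ∀ {A : Set} (xs : List A) {y ys} → toℕ (position xs {y} {ys}) ≡ length xs
toℕ-position []       = refl
toℕ-position (_ ∷ xs) = cong suc (toℕ-position xs)

lookup-position : ∀ {A : Set} (xs : List A) {y ys} → lookup (xs ++ y ∷ ys) (position xs) ≡ y
lookup-position []       = refl
lookup-position (_ ∷ xs) = lookup-position xs

sum-replicate-1 : ∀ n → sum (replicate n 1) ≡ n
sum-replicate-1 zero    = refl
sum-replicate-1 (suc n) = cong suc (sum-replicate-1 n)

IsPartition-irrelevant : ∀ {n λs} → Irrelevant (IsPartition n λs)
IsPartition-irrelevant (l , p , s) (l′ , p′ , s′) =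
  cong₂ _,_ (Linked.irrelevant ℕₚ.≤-irrelevant l l′)
            (cong₂ _,_ (All.irrelevant ℕₚ.≤-irrelevant p p′) (ℕₚ.≡-irrelevant s s′))

IsPartitionℤ-irrelevant : ∀ {m μ} → Irrelevant (IsPartitionℤ m μ)
IsPartitionℤ-irrelevant (k , eq , p) (k′ , eq′ , p′) with ℤₚ.+-injective (trans (sym eq) eq′)
... | refl = cong₂ (λ q r → k , q , r) (ℤ-≡-irrelevant eq eq′) (IsPartition-irrelevant p p′)

ones-after-one : ∀ {xs} → Linked _≥_ (1 ∷ xs) → All (0 <_) xs → xs ≡ replicate (length xs) 1
ones-after-one {[]}              _            _        = refl
ones-after-one {zero ∷ _}        _            (() ∷ _)
ones-after-one {suc zero ∷ _}    (_ ∷ l)      (_ ∷ ps) = cong (1 ∷_) (ones-after-one l ps)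
ones-after-one {suc (suc _) ∷ _} (s≤s () ∷ _) _

split-at-one : ∀ {λs} → Linked _≥_ λs → All (0 <_) λs → (i : Fin (length λs)) → lookup λs i ≡ 1 →
               λs ≡ take (toℕ i) λs ++ 1 ∷ replicate (length λs ∸ suc (toℕ i)) 1
split-at-one {_ ∷ _} l (_ ∷ ps) Fin.zero    refl = cong (1 ∷_) (ones-after-one l ps)
split-at-one {x ∷ _} l (_ ∷ ps) (Fin.suc i) one  =
  cong (x ∷_) (split-at-one (Linked.tail l) ps i one)

sum-++-ones : ∀ ν e → sum (ν ++ 1 ∷ replicate e 1) ≡ sum ν + suc e
sum-++-ones ν e = trans (sum-++ ν _) (cong (λ s → sum ν + s) (sum-replicate-1 (suc e)))

++-ones-isPartition : ∀ {ν} e → Linked _≥_ ν → All (0 <_) ν →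
                      IsPartition (sum ν + suc e) (ν ++ 1 ∷ replicate e 1)
++-ones-isPartition {ν} e l pos =
  Linked-++-∷⁺ l pos (Linked-replicate ℕₚ.≤-refl (suc e)) ,
  ++⁺ pos (replicate⁺ (suc e) (s≤s z≤n)) ,
  sum-++-ones ν e

-- ∣_∣ truncates; it is only applied when length ν + h ≥ 0.
padWithOnes : ℤ → List ℕ → List ℕ
padWithOnes h ν = ν ++ 1 ∷ replicate ∣ + length ν ℤ.+ h ∣ 1

padWithOnes-≡ : ∀ {h} ν {e} → + e ≡ + length ν ℤ.+ h → padWithOnes h ν ≡ ν ++ 1 ∷ replicate e 1
padWithOnes-≡ ν e≡ = cong (λ e → ν ++ 1 ∷ replicate e 1) (cong ∣_∣ (sym e≡))

addFirstColumn : List ℕ → List ℕ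
addFirstColumn ν = map suc ν ++ 1 ∷ []

addFirstColumn-injective : ∀ {ν ν′} → addFirstColumn ν ≡ addFirstColumn ν′ → ν ≡ ν′
addFirstColumn-injective eq = map-injective ℕₚ.suc-injective (++-cancelʳ (1 ∷ []) _ _ eq)

length-addFirstColumn : ∀ ν → length (addFirstColumn ν) ≡ suc (length ν)
length-addFirstColumn []      = refl
length-addFirstColumn (_ ∷ ν) = cong suc (length-addFirstColumn ν)

sum-addFirstColumn : ∀ ν → sum (addFirstColumn ν) ≡ suc (length ν + sum ν)
sum-addFirstColumn []      = refl
sum-addFirstColumn (x ∷ ν) =
  trans (cong (λ s → suc x + s) (sum-addFirstColumn ν)) (rearrange x (length ν) (sum ν))
  where
  rearrange : ∀ x k s → suc x + suc (k + s) ≡ suc (suc k + (x + s))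
  rearrange = ℕ-Solver.solve-∀

addFirstColumn-linked : ∀ {ν} → Linked _≥_ ν → Linked _≥_ (addFirstColumn ν)
addFirstColumn-linked []      = [-]
addFirstColumn-linked [-]     = s≤s z≤n ∷ [-]
addFirstColumn-linked (r ∷ l) = s≤s r ∷ addFirstColumn-linked l

addFirstColumn-linked⁻ : ∀ ν → Linked _≥_ (addFirstColumn ν) → Linked _≥_ ν
addFirstColumn-linked⁻ ν l = Linked.map s≤s⁻¹ (map⁻ (Linked-++⁻ˡ (map suc ν) l))

addFirstColumn-positive : ∀ ν → All (0 <_) (addFirstColumn ν)
addFirstColumn-positive []      = s≤s z≤n ∷ []
addFirstColumn-positive (_ ∷ ν) = s≤s z≤n ∷ addFirstColumn-positive ν

addFirstColumn-isPartition : ∀ {ν} → Linked _≥_ ν →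
                             IsPartition (suc (length ν + sum ν)) (addFirstColumn ν)
addFirstColumn-isPartition {ν} l =
  addFirstColumn-linked l , addFirstColumn-positive ν , sum-addFirstColumn ν

countOnes-addFirstColumn : ∀ {ν} → All (0 <_) ν → countOnes (addFirstColumn ν) ≡ 1
countOnes-addFirstColumn []           = refl
countOnes-addFirstColumn (s≤s _ ∷ ps) = countOnes-addFirstColumn ps

countOnes≡1⇒addFirstColumn : ∀ {μ} → Linked _≥_ μ → All (0 <_) μ → countOnes μ ≡ 1 →
                             Σ (List ℕ) (λ ν → All (0 <_) ν × addFirstColumn ν ≡ μ)
countOnes≡1⇒addFirstColumn {[]}                         _            _            ()
countOnes≡1⇒addFirstColumn {zero ∷ _}                   _            (() ∷ _)     _
countOnes≡1⇒addFirstColumn {suc zero ∷ []}              _            _            _  = [] , [] , refl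
countOnes≡1⇒addFirstColumn {suc zero ∷ zero ∷ _}        _            (_ ∷ () ∷ _) _
countOnes≡1⇒addFirstColumn {suc zero ∷ suc zero ∷ _}    _            _            ()
countOnes≡1⇒addFirstColumn {suc zero ∷ suc (suc _) ∷ _} (s≤s () ∷ _) _            _
countOnes≡1⇒addFirstColumn {suc (suc x) ∷ _}            l            (_ ∷ ps)     c
  with countOnes≡1⇒addFirstColumn (Linked.tail l) ps c
... | ν , ν-positive , refl = suc x ∷ ν , s≤s z≤n ∷ ν-positive , refl

firstColHook-one : ∀ λs (i : Fin (length λs)) → lookup λs i ≡ 1 →
                   firstColHook λs i ≡ + suc (length λs ∸ suc (toℕ i))
firstColHook-one λs i one rewrite one =
  trans (ℤₚ.⊖-≥ (ℕₚ.m≤n⇒m≤1+n (toℕ<n i))) (cong +_ (ℕₚ.+-∸-assoc 1 (toℕ<n i)))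

fixedHook⇔trailingOnes : ∀ {h} λs (i : Fin (length λs)) → lookup λs i ≡ 1 →
                         (firstColHook λs i ≡ + suc (toℕ i) ℤ.+ h)
                         ⇔ (+ (length λs ∸ suc (toℕ i)) ≡ + toℕ i ℤ.+ h)
fixedHook⇔trailingOnes {h} λs i one rewrite firstColHook-one λs i one = mk⇔
  (λ eq → ∙-cancelˡ 1ℤ _ _ (trans eq (ℤₚ.+-assoc 1ℤ (+ toℕ i) h)))
  (λ eq → trans (cong (λ x → 1ℤ ℤ.+ x) eq) (sym (ℤₚ.+-assoc 1ℤ (+ toℕ i) h)))

-- There are i parts before position i and t ∸ suc i after it: their
-- difference h and their sum t - 1 determine i.
trailingOnes-unique : ∀ {t h i j} → i < t → j < t →
                      + (t ∸ suc i) ≡ + i ℤ.+ h → + (t ∸ suc j) ≡ + j ℤ.+ h → i ≡ j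
trailingOnes-unique {t} {h} {i} {j} i<t j<t eqᵢ eqⱼ =
  ℤₚ.+-injective (ℤₚ.*-cancelˡ-≡ (+ 2) (+ i) (+ j)
    (∙-cancelˡ 1ℤ _ _ (∙-cancelʳ h _ _ (trans (sym (length≡ i<t eqᵢ)) (length≡ j<t eqⱼ)))))
  where
  open ≡-Reasoning
  length≡ : ∀ {k} → k < t → + (t ∸ suc k) ≡ + k ℤ.+ h → + t ≡ (1ℤ ℤ.+ + 2 ℤ.* + k) ℤ.+ h
  length≡ {k} k<t eq = begin
    + t                               ≡⟨ cong +_ (ℕₚ.m+[n∸m]≡n k<t) ⟨
    (1ℤ ℤ.+ + k) ℤ.+ + (t ∸ suc k)   ≡⟨ cong (λ x → (1ℤ ℤ.+ + k) ℤ.+ x) eq ⟩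
    (1ℤ ℤ.+ + k) ℤ.+ (+ k ℤ.+ h)     ≡⟨ regroup (+ k) h ⟩
    (1ℤ ℤ.+ + 2 ℤ.* + k) ℤ.+ h       ∎
    where
    regroup : ∀ K h → (1ℤ ℤ.+ K) ℤ.+ (K ℤ.+ h) ≡ (1ℤ ℤ.+ + 2 ℤ.* K) ℤ.+ h
    regroup = solve-∀

HasFixedHookFromOne-irrelevant : ∀ {h λs} → Irrelevant (HasFixedHookFromOne h λs)
HasFixedHookFromOne-irrelevant {h} {λs} (i , one , hook) (j , one′ , hook′)
  with toℕ-injective (trailingOnes-unique {h = h} (toℕ<n i) (toℕ<n j)
         (Equivalence.to (fixedHook⇔trailingOnes {h} λs i one) hook)
         (Equivalence.to (fixedHook⇔trailingOnes {h} λs j one′) hook′))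
... | refl = cong₂ (λ p q → i , p , q) (ℕₚ.≡-irrelevant one one′) (ℤ-≡-irrelevant hook hook′)

ones-after-position : ∀ ν e →
  length (ν ++ 1 ∷ replicate e 1) ∸ suc (toℕ (position ν {1} {replicate e 1})) ≡ e
ones-after-position []      e = length-replicate e
ones-after-position (_ ∷ ν) e = ones-after-position ν e

++-ones-hasFixedHookFromOne : ∀ {h} ν e → + e ≡ + length ν ℤ.+ h →
                              HasFixedHookFromOne h (ν ++ 1 ∷ replicate e 1)
++-ones-hasFixedHookFromOne {h} ν e e≡ =
  position ν , lookup-position ν ,
  Equivalence.from (fixedHook⇔trailingOnes {h} λs (position ν) (lookup-position ν)) trailing
  where
  open ≡-Reasoning
  λs = ν ++ 1 ∷ replicate e 1
  trailing : + (length λs ∸ suc (toℕ (position ν))) ≡ + toℕ (position ν) ℤ.+ h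
  trailing = begin
    + (length λs ∸ suc (toℕ (position ν))) ≡⟨ cong +_ (ones-after-position ν e) ⟩
    + e                                     ≡⟨ e≡ ⟩
    + length ν ℤ.+ h                        ≡⟨ cong (λ k → + k ℤ.+ h) (toℕ-position ν) ⟨
    + toℕ (position ν) ℤ.+ h                ∎

sizes⇔ : ∀ {s k e n h} → + e ≡ + k ℤ.+ h → (s + suc e ≡ n) ⇔ (+ n - h ≡ + suc (k + s))
sizes⇔ {s} {k} {e} {n} {h} e≡ = mk⇔
  (λ eq → begin
     + n - h                      ≡⟨ cong (λ m → + m - h) eq ⟨
     + (s + suc e) - h            ≡⟨ cong (_- h) shift ⟩
     (+ suc (k + s) ℤ.+ h) - h    ≡⟨ cancel (+ suc (k + s)) h ⟩
     + suc (k + s)                ∎)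
  (λ eq → ℤₚ.+-injective (begin
     + (s + suc e)                ≡⟨ shift ⟩
     + suc (k + s) ℤ.+ h          ≡⟨ cong (ℤ._+ h) eq ⟨
     (+ n - h) ℤ.+ h              ≡⟨ uncancel (+ n) h ⟩
     + n                          ∎))
  where
  open ≡-Reasoning
  regroup : ∀ S K h → S ℤ.+ (1ℤ ℤ.+ (K ℤ.+ h)) ≡ (1ℤ ℤ.+ (K ℤ.+ S)) ℤ.+ h
  regroup = solve-∀
  cancel : ∀ X h → (X ℤ.+ h) - h ≡ X
  cancel = solve-∀
  uncancel : ∀ X h → (X - h) ℤ.+ h ≡ X
  uncancel = solve-∀
  shift : + (s + suc e) ≡ + suc (k + s) ℤ.+ h
  shift = trans (cong (λ x → + s ℤ.+ (1ℤ ℤ.+ x)) e≡) (regroup (+ s) (+ k) h)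

lengths⇔ : ∀ k h → (1ℤ - h ≤ + suc k) ⇔ (0ℤ ≤ + k ℤ.+ h)
lengths⇔ k h = mk⇔
  (λ le → subst (0ℤ ≤_) (gap (+ k) h) (ℤₚ.i≤j⇒0≤j-i le))
  (λ le → ℤₚ.0≤i-j⇒j≤i (subst (0ℤ ≤_) (sym (gap (+ k) h)) le))
  where
  gap : ∀ K h → (1ℤ ℤ.+ K) - (1ℤ - h) ≡ K ℤ.+ h
  gap = solve-∀

module TrailingOnes {h λs} (l : Linked _≥_ λs) (pos : All (0 <_) λs)
                    (i : Fin (length λs)) (one : lookup λs i ≡ 1)
                    (hook : firstColHook λs i ≡ + suc (toℕ i) ℤ.+ h) where

  ν : List ℕ
  ν = take (toℕ i) λs

  e : ℕ
  e = length λs ∸ suc (toℕ i)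

  λs≡ : λs ≡ ν ++ 1 ∷ replicate e 1
  λs≡ = split-at-one l pos i one

  e≡ : + e ≡ + length ν ℤ.+ h
  e≡ = trans (Equivalence.to (fixedHook⇔trailingOnes {h} λs i one) hook)
             (cong (λ k → + k ℤ.+ h) (sym length-ν))
    where
    length-ν : length ν ≡ toℕ i
    length-ν = trans (length-take (toℕ i) λs) (ℕₚ.m≤n⇒m⊓n≡m (ℕₚ.<⇒≤ (toℕ<n i)))

  ν-linked : Linked _≥_ ν
  ν-linked = Linked-++⁻ˡ ν (subst (Linked _≥_) λs≡ l)

  ν-positive : All (0 <_) ν
  ν-positive = take⁺ (toℕ i) pos

module FirstColumn {μ} (l : Linked _≥_ μ) (pos : All (0 <_) μ) (ones : countOnes μ ≡ 1) where

  private
    decomposition = countOnes≡1⇒addFirstColumn l pos ones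

  ν : List ℕ
  ν = proj₁ decomposition

  ν-positive : All (0 <_) ν
  ν-positive = proj₁ (proj₂ decomposition)

  μ≡ : addFirstColumn ν ≡ μ
  μ≡ = proj₂ (proj₂ decomposition)

  ν-linked : Linked _≥_ ν
  ν-linked = addFirstColumn-linked⁻ ν (subst (Linked _≥_) (sym μ≡) l)

  length-μ : length μ ≡ suc (length ν)
  length-μ = trans (cong length (sym μ≡)) (length-addFirstColumn ν)

  sum-μ : sum μ ≡ suc (length ν + sum ν)
  sum-μ = trans (cong sum (sym μ≡)) (sum-addFirstColumn ν)

FixedHookPartitions : ℤ → ℕ → Set
FixedHookPartitions h n = Σ (List ℕ) (λ λs → IsPartition n λs × HasFixedHookFromOne h λs)

SingleOnePartitions : ℤ → ℕ → Set
SingleOnePartitions h n =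
  Σ (List ℕ) (λ μ → IsPartitionℤ (+ n - h) μ × (1ℤ - h ≤ + length μ) × (countOnes μ ≡ 1))

fixedHook→singleOne : ∀ {h n} → FixedHookPartitions h n → SingleOnePartitions h n
fixedHook→singleOne {h} {n} (λs , (l , pos , sum≡n) , (i , one , hook)) =
  addFirstColumn ν ,
  (_ , Equivalence.to (sizes⇔ {h = h} e≡) sum-ν , addFirstColumn-isPartition ν-linked) ,
  subst (λ t → 1ℤ - h ≤ + t) (sym (length-addFirstColumn ν))
        (Equivalence.from (lengths⇔ (length ν) h) (subst (0ℤ ≤_) e≡ (+≤+ z≤n))) ,
  countOnes-addFirstColumn ν-positive
  where
  open TrailingOnes {h} l pos i one hook
  sum-ν : sum ν + suc e ≡ n
  sum-ν = trans (sym (sum-++-ones ν e)) (trans (cong sum (sym λs≡)) sum≡n)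

singleOne→fixedHook : ∀ {h n} → SingleOnePartitions h n → FixedHookPartitions h n
singleOne→fixedHook {h} {n} (μ , (m , n-h≡m , (l , pos , sum≡m)) , len , ones) =
  padWithOnes h ν ,
  subst (λ k → IsPartition k (padWithOnes h ν)) sum-λs (++-ones-isPartition e ν-linked ν-positive) ,
  ++-ones-hasFixedHookFromOne {h} ν e e≡
  where
  open FirstColumn l pos ones
  e = ∣ + length ν ℤ.+ h ∣
  e≡ : + e ≡ + length ν ℤ.+ h
  e≡ = ℤₚ.0≤i⇒+∣i∣≡i
         (Equivalence.to (lengths⇔ (length ν) h) (subst (λ t → 1ℤ - h ≤ + t) length-μ len))
  sum-λs : sum ν + suc e ≡ n
  sum-λs = Equivalence.from (sizes⇔ {h = h} e≡) (trans n-h≡m (cong +_ (trans (sym sum≡m) sum-μ)))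

singleOne→fixedHook→singleOne : ∀ {h n} (y : SingleOnePartitions h n) →
  proj₁ (fixedHook→singleOne {h} {n} (singleOne→fixedHook {h} {n} y)) ≡ proj₁ y
singleOne→fixedHook→singleOne {h} (μ , (_ , _ , (l , pos , _)) , _ , ones) = begin
  addFirstColumn (take (toℕ (position ν)) (padWithOnes h ν))
    ≡⟨ cong (λ k → addFirstColumn (take k (padWithOnes h ν))) (toℕ-position ν) ⟩
  addFirstColumn (take (length ν) (padWithOnes h ν))
    ≡⟨ cong addFirstColumn (take-length-++ ν) ⟩
  addFirstColumn ν
    ≡⟨ μ≡ ⟩
  μ ∎
  where
  open ≡-Reasoning
  open FirstColumn l pos ones

fixedHook→singleOne→fixedHook : ∀ {h n} (x : FixedHookPartitions h n) →
  proj₁ (singleOne→fixedHook {h} {n} (fixedHook→singleOne {h} {n} x)) ≡ proj₁ x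
fixedHook→singleOne→fixedHook {h} (λs , (l , pos , _) , (i , one , hook)) = begin
  padWithOnes h F.ν        ≡⟨ cong (padWithOnes h) (addFirstColumn-injective F.μ≡) ⟩
  padWithOnes h ν          ≡⟨ padWithOnes-≡ {h} ν e≡ ⟩
  ν ++ 1 ∷ replicate e 1   ≡⟨ λs≡ ⟨
  λs                       ∎
  where
  open ≡-Reasoning
  open TrailingOnes {h} l pos i one hook
  module F = FirstColumn (addFirstColumn-linked ν-linked) (addFirstColumn-positive ν)
                         (countOnes-addFirstColumn ν-positive)

mainTheorem4 : (h : ℤ) (n : ℕ) →
    Σ (List ℕ) (λ λs → IsPartition n λs × HasFixedHookFromOne h λs)
    ↔
    Σ (List ℕ) (λ μ → IsPartitionℤ (+ n - h) μ
                    × (1ℤ - h ≤ + length μ)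
                    × (countOnes μ ≡ 1))
mainTheorem4 h n =
  mk↔-irrelevant
    (λ {λs} (p , q) (p′ , q′) →
       cong₂ _,_ (IsPartition-irrelevant p p′) (HasFixedHookFromOne-irrelevant {h} {λs} q q′))
    (λ (p , q , r) (p′ , q′ , r′) →
       cong₂ _,_ (IsPartitionℤ-irrelevant p p′)
                 (cong₂ _,_ (ℤₚ.≤-irrelevant q q′) (ℕₚ.≡-irrelevant r r′)))
    (fixedHook→singleOne {h} {n}) (singleOne→fixedHook {h} {n})
    (singleOne→fixedHook→singleOne {h} {n}) (fixedHook→singleOne→fixedHook {h} {n})
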